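{- Let $d>0$, $\zeta>0$ and $0\le\rho<\frac{d\zeta^3}{27}$. Let $H$ be a $(\rho,d)$-dense $3$-graph. Then $H$ admits a matching covering all but at most $\max\{2,\zeta|V(H)|\}$ vertices.
   Context: A $3$-graph is a $3$-uniform hypergraph. For $X\subseteq V(H)$ let $e_H(X)=|E(H)\cap\binom{X}{3}|$. A $3$-graph $H$ on $n$ vertices is $(\rho,d)$-dense if $e_H(X)\geq d\binom{|X|}{3}-\rho n^3$ for every $X\subseteq V(H)$. A matching is a set of pairwise disjoint edges.
   Formalization: The parameters d, ζ and ρ range over the rationals. -}

module Defs where

open import Data.Nat using (ℕ; _^_; _∸_)
open import Data.Nat.Combinatorics using (_C_)
open import Data.Integer using (+_)
open import Data.Rational using (ℚ; _/_; _*_; _-_; _≤_; _⊔_)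
open import Data.List using (List; filter; length)
open import Data.List.Membership.Propositional using (_∈_)
open import Data.List.Relation.Unary.All using (All)
open import Data.List.Relation.Unary.Unique.Propositional using (Unique)
open import Data.List.Relation.Unary.AllPairs using (AllPairs)
open import Data.Fin.Subset using (Subset; ∣_∣; _⊆_; _∩_; ⊥; ⋃)
open import Data.Fin.Subset.Properties using (_⊆?_)
open import Relation.Binary.PropositionalEquality using (_≡_)

ℕ→ℚ : ℕ → ℚ
ℕ→ℚ n = + n / 1

record ThreeGraph (n : ℕ) : Set where
  field
    edges   : List (Subset n)
    uniform : All (λ e → ∣ e ∣ ≡ 3) edges
    unique  : Unique edges
open ThreeGraph public

eH : ∀ {n} → ThreeGraph n → Subset n → ℕ
eH H X = length (filter (λ e → e ⊆? X) (edges H))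

Dense : ∀ {n} → ℚ → ℚ → ThreeGraph n → Set
Dense {n} ρ d H =
  ∀ (X : Subset n) → d * ℕ→ℚ (∣ X ∣ C 3) - ρ * ℕ→ℚ (n ^ 3) ≤ ℕ→ℚ (eH H X)

Disjoint : ∀ {n} → Subset n → Subset n → Set
Disjoint p q = p ∩ q ≡ ⊥

record Matching {n : ℕ} (H : ThreeGraph n) : Set where
  field
    medges   : List (Subset n)
    inH      : All (λ e → e ∈ edges H) medges
    disjoint : AllPairs Disjoint medges
open Matching public

uncovered : ∀ {n} {H : ThreeGraph n} → Matching H → ℕ
uncovered {n} M = n ∸ ∣ ⋃ (medges M) ∣

-- A maximal matching M leaves an independent set X of uncovered vertices, so density gives
-- d·C(|X|,3) ≤ ρn³ < (d/27)(ζn)³. If |X| ≥ 3 then |X|³ ≤ 27·C(|X|,3), which forces |X| ≤ ζn.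
module Submission where

open import Defs
open import Data.Nat as ℕ using (ℕ; zero; suc; s≤s)
import Data.Nat.Properties as ℕ
open import Data.Nat.Combinatorics using (_C_; nCk+nC[k+1]≡[n+1]C[k+1]; nC1≡n)
open import Data.Nat.Tactic.RingSolver using (solve)
open import Data.Nat.Coprimality as Coprime using (1-coprimeTo)
open import Data.Integer as ℤ using (+_)
import Data.Integer.Properties as ℤ
open import Data.Rational
  using (ℚ; mkℚ; 0ℚ; 1ℚ; _/_; _*_; _-_; -_; _⊔_; _≤_; _<_; *≤*; _≤?_; NonNegative; Positive; positive; nonNegative)
open import Data.Rational.Properties
open import Algebra.Solver.CommutativeMonoid *-1-commutativeMonoid using (prove; var; _⊕_)
open import Data.Fin using () renaming (zero to fzero; suc to fsuc)
open import Data.Fin.Subset using (Subset; ∣_∣; _∩_; ∁; ⋃; Nonempty) renaming (_⊆_ to _⊆ₛ_)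
open import Data.Fin.Subset.Properties
  using (_⊆?_; nonempty?; Empty-unique; ∣⊥∣≡0; x∈p∩q⁺; x∈p∩q⁻; x∈p∪q⁺; x∈∁p⇒x∉p; ∣∁p∣≡n∸∣p∣)
open import Data.List using (List; []; _∷_; [_]; length)
open import Data.List.Properties using (filter-none)
open import Data.List.Relation.Unary.All as All using (All; []; _∷_)
open import Data.List.Relation.Unary.All.Properties using (¬Any⇒All¬)
open import Data.List.Relation.Unary.Any using (Any; here; there; any?)
open import Data.List.Relation.Unary.AllPairs using (AllPairs; []; _∷_)
open import Data.List.Relation.Binary.Sublist.Propositional as Sublist using ([]; _∷_; _∷ʳ_; lookup)
open import Data.Product using (Σ; _,_)
open import Data.Sum using (inj₁; inj₂)
open import Data.Vec using ([]; _∷_)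
open import Data.Empty using (⊥-elim)
open import Relation.Nullary using (¬_; yes; no; contradiction)
open import Relation.Binary.PropositionalEquality using (_≡_; refl; sym; trans; cong; cong₂; subst; subst₂; module ≡-Reasoning)

2*[1+m]C2≡[1+m]*m : ∀ m → 2 ℕ.* (suc m C 2) ≡ suc m ℕ.* m
2*[1+m]C2≡[1+m]*m zero    = refl
2*[1+m]C2≡[1+m]*m (suc m) = begin
  2 ℕ.* (suc (suc m) C 2)                 ≡⟨ cong (2 ℕ.*_) (nCk+nC[k+1]≡[n+1]C[k+1] (suc m) 1) ⟨
  2 ℕ.* (suc m C 1 ℕ.+ suc m C 2)         ≡⟨ ℕ.*-distribˡ-+ 2 (suc m C 1) (suc m C 2) ⟩
  2 ℕ.* (suc m C 1) ℕ.+ 2 ℕ.* (suc m C 2) ≡⟨ cong₂ (λ a b → 2 ℕ.* a ℕ.+ b) (nC1≡n (suc m)) (2*[1+m]C2≡[1+m]*m m) ⟩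
  2 ℕ.* suc m ℕ.+ suc m ℕ.* m             ≡⟨ solve [ m ] ⟩
  suc (suc m) ℕ.* suc m                   ∎
  where open ≡-Reasoning

6*[2+m]C3≡[2+m]*[1+m]*m : ∀ m → 6 ℕ.* (suc (suc m) C 3) ≡ suc (suc m) ℕ.* suc m ℕ.* m
6*[2+m]C3≡[2+m]*[1+m]*m zero    = refl
6*[2+m]C3≡[2+m]*[1+m]*m (suc m) = begin
  6 ℕ.* ((3 ℕ.+ m) C 3)
    ≡⟨ cong (6 ℕ.*_) (nCk+nC[k+1]≡[n+1]C[k+1] (2 ℕ.+ m) 2) ⟨
  6 ℕ.* ((2 ℕ.+ m) C 2 ℕ.+ (2 ℕ.+ m) C 3)
    ≡⟨ ℕ.*-distribˡ-+ 6 ((2 ℕ.+ m) C 2) ((2 ℕ.+ m) C 3) ⟩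
  6 ℕ.* ((2 ℕ.+ m) C 2) ℕ.+ 6 ℕ.* ((2 ℕ.+ m) C 3)
    ≡⟨ cong (ℕ._+ 6 ℕ.* ((2 ℕ.+ m) C 3)) (ℕ.*-assoc 3 2 ((2 ℕ.+ m) C 2)) ⟩
  3 ℕ.* (2 ℕ.* ((2 ℕ.+ m) C 2)) ℕ.+ 6 ℕ.* ((2 ℕ.+ m) C 3)
    ≡⟨ cong₂ (λ a b → 3 ℕ.* a ℕ.+ b) (2*[1+m]C2≡[1+m]*m (suc m)) (6*[2+m]C3≡[2+m]*[1+m]*m m) ⟩
  3 ℕ.* ((2 ℕ.+ m) ℕ.* (1 ℕ.+ m)) ℕ.+ (2 ℕ.+ m) ℕ.* (1 ℕ.+ m) ℕ.* m
    ≡⟨ solve [ m ] ⟩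
  (3 ℕ.+ m) ℕ.* (2 ℕ.+ m) ℕ.* (1 ℕ.+ m)
    ∎
  where open ≡-Reasoning

-- 9n(n − 1)(n − 2) − 2n³ = n(7n² − 27n + 18), which is (3 + k)(7k² + 15k) for n = 3 + k.
n³≤27*nC3 : ∀ {n} → 3 ℕ.≤ n → n ℕ.* n ℕ.* n ℕ.≤ 27 ℕ.* (n C 3)
n³≤27*nC3 {n@(suc (suc (suc k)))} (s≤s (s≤s (s≤s _))) = ℕ.*-cancelˡ-≤ 2 (begin
  2 ℕ.* (n ℕ.* n ℕ.* n)
    ≤⟨ ℕ.m≤m+n _ _ ⟩
  2 ℕ.* (n ℕ.* n ℕ.* n) ℕ.+ n ℕ.* (7 ℕ.* k ℕ.* k ℕ.+ 15 ℕ.* k)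
    ≡⟨ solve [ k ] ⟩
  9 ℕ.* (n ℕ.* (2 ℕ.+ k) ℕ.* (1 ℕ.+ k))
    ≡⟨ cong (9 ℕ.*_) (6*[2+m]C3≡[2+m]*[1+m]*m (suc k)) ⟨
  9 ℕ.* (6 ℕ.* (n C 3))
    ≡⟨ trans (sym (ℕ.*-assoc 9 6 (n C 3))) (ℕ.*-assoc 2 27 (n C 3)) ⟩
  2 ℕ.* (27 ℕ.* (n C 3))
    ∎)
  where open ℕ.≤-Reasoning

ℕ→ℚ-nonNeg : ∀ m → NonNegative (ℕ→ℚ m)
ℕ→ℚ-nonNeg m = normalize-nonNeg m 1

ℕ→ℚ≡mkℚ : ∀ m → ℕ→ℚ m ≡ mkℚ (+ m) 0 (Coprime.sym (1-coprimeTo m))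
ℕ→ℚ≡mkℚ m = normalize-coprime (Coprime.sym (1-coprimeTo m))

ℕ→ℚ-* : ∀ m n → ℕ→ℚ (m ℕ.* n) ≡ ℕ→ℚ m * ℕ→ℚ n
ℕ→ℚ-* m n rewrite ℕ→ℚ≡mkℚ m | ℕ→ℚ≡mkℚ n = cong (_/ 1) (ℤ.pos-* m n)

ℕ→ℚ-mono-≤ : ∀ {m n} → m ℕ.≤ n → ℕ→ℚ m ≤ ℕ→ℚ n
ℕ→ℚ-mono-≤ {m} {n} m≤n rewrite ℕ→ℚ≡mkℚ m | ℕ→ℚ≡mkℚ n =
  *≤* (subst₂ ℤ._≤_ (sym (ℤ.*-identityʳ (+ m))) (sym (ℤ.*-identityʳ (+ n))) (ℤ.+≤+ m≤n))

ℕ→ℚ-^3 : ∀ m → ℕ→ℚ (m ℕ.^ 3) ≡ ℕ→ℚ m * ℕ→ℚ m * ℕ→ℚ m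
ℕ→ℚ-^3 m = begin
  ℕ→ℚ (m ℕ.* (m ℕ.* (m ℕ.* 1))) ≡⟨ cong (λ t → ℕ→ℚ (m ℕ.* (m ℕ.* t))) (ℕ.*-identityʳ m) ⟩
  ℕ→ℚ (m ℕ.* (m ℕ.* m))         ≡⟨ cong ℕ→ℚ (ℕ.*-assoc m m m) ⟨
  ℕ→ℚ (m ℕ.* m ℕ.* m)           ≡⟨ ℕ→ℚ-* (m ℕ.* m) m ⟩
  ℕ→ℚ (m ℕ.* m) * ℕ→ℚ m         ≡⟨ cong (_* ℕ→ℚ m) (ℕ→ℚ-* m m) ⟩
  ℕ→ℚ m * ℕ→ℚ m * ℕ→ℚ m         ∎
  where open ≡-Reasoning

cube-mono-< : ∀ {p q} → 0ℚ ≤ p → p < q → p * p * p < q * q * q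
cube-mono-< {p} {q} 0≤p p<q = begin-strict
  p * p * p  ≤⟨ *-monoʳ-≤-nonNeg p {{nonNegative 0≤p}} p*p≤q*q ⟩
  q * q * p  <⟨ *-monoʳ-<-pos (q * q) {{pos*pos⇒pos q q}} p<q ⟩
  q * q * q  ∎
  where
  open ≤-Reasoning
  instance
    q-pos : Positive q
    q-pos = positive (≤-<-trans 0≤p p<q)
  p*p≤q*q : p * p ≤ q * q
  p*p≤q*q = ≤-trans (*-monoˡ-≤-nonNeg p {{nonNegative 0≤p}} (<⇒≤ p<q))
                    (*-monoʳ-≤-nonNeg q {{pos⇒nonNeg q}} (<⇒≤ p<q))

ρn³<d*uC3 : ∀ {d ζ ρ} n {u} → 0ℚ < d → 0ℚ < ζ → ρ < d * ζ * ζ * ζ * (+ 1 / 27) →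
  3 ℕ.≤ u → ζ * ℕ→ℚ n < ℕ→ℚ u → ρ * ℕ→ℚ (n ℕ.^ 3) < d * ℕ→ℚ (u C 3)
ρn³<d*uC3 {d} {ζ} {ρ} n {u} 0<d 0<ζ ρ<dζ³/27 3≤u ζn<u = begin-strict
  ρ * ℕ→ℚ (n ℕ.^ 3)
    ≤⟨ *-monoʳ-≤-nonNeg (ℕ→ℚ (n ℕ.^ 3)) {{ℕ→ℚ-nonNeg (n ℕ.^ 3)}} (<⇒≤ ρ<dζ³/27) ⟩
  d * ζ * ζ * ζ * k * ℕ→ℚ (n ℕ.^ 3)
    ≡⟨ cong (d * ζ * ζ * ζ * k *_) (ℕ→ℚ-^3 n) ⟩
  d * ζ * ζ * ζ * k * (N * N * N)
    ≡⟨ regroup d ζ k N ⟩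
  d * k * (ζ * N * (ζ * N) * (ζ * N))
    <⟨ *-monoʳ-<-pos (d * k) (cube-mono-< 0≤ζN ζn<u) ⟩
  d * k * (U * U * U)
    ≤⟨ *-monoˡ-≤-nonNeg (d * k) {{pos⇒nonNeg (d * k)}} u³≤27uC3 ⟩
  d * k * (ℕ→ℚ 27 * binom)
    ≡⟨ *-assoc d k (ℕ→ℚ 27 * binom) ⟩
  d * (k * (ℕ→ℚ 27 * binom))
    ≡⟨ cong (d *_) (*-assoc k (ℕ→ℚ 27) binom) ⟨  -- k * ℕ→ℚ 27 computes to 1ℚ
  d * (1ℚ * binom)
    ≡⟨ cong (d *_) (*-identityˡ binom) ⟩
  d * binom
    ∎
  where
  open ≤-Reasoning
  k N U binom : ℚ
  k = + 1 / 27
  N = ℕ→ℚ n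
  U = ℕ→ℚ u
  binom = ℕ→ℚ (u C 3)
  instance
    d-pos : Positive d
    d-pos = positive 0<d
    dk-pos : Positive (d * k)
    dk-pos = pos*pos⇒pos d k
  regroup : ∀ a b c x → a * b * b * b * c * (x * x * x) ≡ a * c * (b * x * (b * x) * (b * x))
  regroup a b c x = prove 4
    (((((α ⊕ β) ⊕ β) ⊕ β) ⊕ γ) ⊕ ((ξ ⊕ ξ) ⊕ ξ)) ((α ⊕ γ) ⊕ (((β ⊕ ξ) ⊕ (β ⊕ ξ)) ⊕ (β ⊕ ξ)))
    (a ∷ b ∷ c ∷ x ∷ [])
    where
    α = var fzero
    β = var (fsuc fzero)
    γ = var (fsuc (fsuc fzero))
    ξ = var (fsuc (fsuc (fsuc fzero)))
  0≤ζN : 0ℚ ≤ ζ * N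
  0≤ζN = nonNegative⁻¹ (ζ * N) {{nonNeg*nonNeg⇒nonNeg ζ {{pos⇒nonNeg ζ {{positive 0<ζ}}}} N {{ℕ→ℚ-nonNeg n}}}}
  u³≤27uC3 : U * U * U ≤ ℕ→ℚ 27 * binom
  u³≤27uC3 = subst₂ _≤_
    (trans (ℕ→ℚ-* (u ℕ.* u) u) (cong (_* U) (ℕ→ℚ-* u u)))
    (ℕ→ℚ-* 27 (u C 3))
    (ℕ→ℚ-mono-≤ (n³≤27*nC3 3≤u))

u≤2⊔ζn : ∀ {d ζ ρ} n u → 0ℚ < d → 0ℚ < ζ → ρ < d * ζ * ζ * ζ * (+ 1 / 27) →
  d * ℕ→ℚ (u C 3) - ρ * ℕ→ℚ (n ℕ.^ 3) ≤ 0ℚ → ℕ→ℚ u ≤ ℕ→ℚ 2 ⊔ ζ * ℕ→ℚ n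
u≤2⊔ζn {d} {ζ} {ρ} n u 0<d 0<ζ ρ<dζ³/27 X-Y≤0 with u ℕ.≤? 2 | ℕ→ℚ u ≤? ζ * ℕ→ℚ n
... | yes u≤2 | _        = p≤q⇒p≤q⊔r (ζ * ℕ→ℚ n) (ℕ→ℚ-mono-≤ u≤2)
... | no _    | yes u≤ζn = p≤q⇒p≤r⊔q (ℕ→ℚ 2) u≤ζn
... | no u≰2  | no u≰ζn  = ⊥-elim (<-irrefl refl (<-≤-trans 0<X-Y X-Y≤0))
  where
  X Y : ℚ
  X = d * ℕ→ℚ (u C 3)
  Y = ρ * ℕ→ℚ (n ℕ.^ 3)
  0<X-Y : 0ℚ < X - Y
  0<X-Y = subst (_< X - Y) (+-inverseʳ Y)
    (+-monoˡ-< (- Y) (ρn³<d*uC3 n 0<d 0<ζ ρ<dζ³/27 (ℕ.≰⇒> u≰2) (≰⇒> u≰ζn)))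

Meets : ∀ {n} → Subset n → Subset n → Set
Meets p q = Nonempty (p ∩ q)

∣p∣≡1+k⇒Nonempty : ∀ {n k} {p : Subset n} → ∣ p ∣ ≡ suc k → Nonempty p
∣p∣≡1+k⇒Nonempty {n} {k} {p} ∣p∣≡1+k with nonempty? p
... | yes nonempty = nonempty
... | no  empty    = contradiction 0≡1+k ℕ.0≢1+n
  where
  0≡1+k : 0 ≡ suc k
  0≡1+k = trans (sym (∣⊥∣≡0 n)) (trans (cong ∣_∣ (sym (Empty-unique empty))) ∣p∣≡1+k)

Any-Meets⇒Meets-⋃ : ∀ {n} {p : Subset n} {qs} → Any (Meets p) qs → Meets p (⋃ qs)
Any-Meets⇒Meets-⋃ {p = p} {q ∷ qs} (here (x , x∈p∩q)) with x∈p∩q⁻ p q x∈p∩q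
... | x∈p , x∈q = x , x∈p∩q⁺ (x∈p , x∈p∪q⁺ (inj₁ x∈q))
Any-Meets⇒Meets-⋃ {p = p} {q ∷ qs} (there meets) with Any-Meets⇒Meets-⋃ meets
... | x , x∈p∩⋃qs with x∈p∩q⁻ p (⋃ qs) x∈p∩⋃qs
... | x∈p , x∈⋃qs = x , x∈p∩q⁺ (x∈p , x∈p∪q⁺ (inj₂ x∈⋃qs))

Meets⇒⊈∁ : ∀ {n} {p q : Subset n} → Meets p q → ¬ (p ⊆ₛ ∁ q)
Meets⇒⊈∁ {p = p} {q} (x , x∈p∩q) p⊆∁q with x∈p∩q⁻ p q x∈p∩q
... | x∈p , x∈q = x∈∁p⇒x∉p (p⊆∁q x∈p) x∈q

record MaximalDisjointSublist {n} (ps : List (Subset n)) : Set where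
  constructor mkMaximalDisjointSublist
  field
    chosen   : List (Subset n)
    sublist  : chosen Sublist.⊆ ps
    disjoint : AllPairs Disjoint chosen
    maximal  : All (λ p → Nonempty p → Any (Meets p) chosen) ps

maximalDisjointSublist : ∀ {n} (ps : List (Subset n)) → MaximalDisjointSublist ps
maximalDisjointSublist [] = mkMaximalDisjointSublist [] [] [] []
maximalDisjointSublist (p ∷ ps) with maximalDisjointSublist ps
... | mkMaximalDisjointSublist qs qs⊆ps disj max with any? (λ q → nonempty? (p ∩ q)) qs
...   | yes hit  = mkMaximalDisjointSublist qs (p ∷ʳ qs⊆ps) disj ((λ _ → hit) ∷ max)
...   | no  miss = mkMaximalDisjointSublist (p ∷ qs) (refl ∷ qs⊆ps)
  (All.map Empty-unique (¬Any⇒All¬ qs miss) ∷ disj)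
  ((λ (x , x∈p) → here (x , x∈p∩q⁺ (x∈p , x∈p))) ∷ All.map (λ hit p≢∅ → there (hit p≢∅)) max)

maximalMatching : ∀ {n} (H : ThreeGraph n) → Σ (Matching H) (λ M → eH H (∁ (⋃ (medges M))) ≡ 0)
maximalMatching H with maximalDisjointSublist (edges H)
... | mkMaximalDisjointSublist ms ms⊆E disj max =
  M , cong length (filter-none (_⊆? ∁ (⋃ ms)) uncovered-edgeless)
  where
  M : Matching H
  M = record { medges = ms ; inH = All.tabulate (lookup ms⊆E) ; disjoint = disj }
  uncovered-edgeless : All (λ e → ¬ (e ⊆ₛ ∁ (⋃ ms))) (edges H)
  uncovered-edgeless = All.zipWith
    (λ (hit , ∣e∣≡3) → Meets⇒⊈∁ (Any-Meets⇒Meets-⋃ (hit (∣p∣≡1+k⇒Nonempty ∣e∣≡3))))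
    (max , uniform H)

lemma5p3 : (d ζ ρ : ℚ) → 0ℚ < d → 0ℚ < ζ → 0ℚ ≤ ρ → ρ < d * ζ * ζ * ζ * (+ 1 / 27) →
    (n : ℕ) (H : ThreeGraph n) → Dense ρ d H →
    Σ (Matching H) (λ M → ℕ→ℚ (uncovered M) ≤ (ℕ→ℚ 2 ⊔ (ζ * ℕ→ℚ n)))
lemma5p3 d ζ ρ 0<d 0<ζ _ ρ<dζ³/27 n H dense with maximalMatching H
... | M , edgeless =
  M , subst (λ u → ℕ→ℚ u ≤ ℕ→ℚ 2 ⊔ ζ * ℕ→ℚ n) (∣∁p∣≡n∸∣p∣ (⋃ (medges M))) ∣X∣≤2⊔ζn
  where
  X : Subset n
  X = ∁ (⋃ (medges M))
  density-on-X : d * ℕ→ℚ (∣ X ∣ C 3) - ρ * ℕ→ℚ (n ℕ.^ 3) ≤ 0ℚ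
  density-on-X = subst (λ e → d * ℕ→ℚ (∣ X ∣ C 3) - ρ * ℕ→ℚ (n ℕ.^ 3) ≤ ℕ→ℚ e) edgeless (dense X)
  ∣X∣≤2⊔ζn : ℕ→ℚ ∣ X ∣ ≤ ℕ→ℚ 2 ⊔ ζ * ℕ→ℚ n
  ∣X∣≤2⊔ζn = u≤2⊔ζn n ∣ X ∣ 0<d 0<ζ ρ<dζ³/27 density-on-X
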